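{- Let $ns_1, ns_2$ be independent lenses into $\Sigma$ ($ns_1\bowtie ns_2$), let $\sigma,\rho:\Sigma\to\Sigma$, let $x:V\Rightarrow\Sigma$ be a lens and $v$ a $V$-valued expression over the state. Then: (1) $id[ns_1|ns_2]id = id$; (2) $\sigma[ns_1|ns_2]\rho = \rho[ns_2|ns_1]\sigma$; (3) if $x\preceq ns_1$ then $(\sigma(x\mapsto v))[ns_1|ns_2]\rho = (\sigma[ns_1|ns_2]\rho)(x\mapsto v)$; (4) if $x\bowtie ns_1$ then $(\sigma(x\mapsto v))[ns_1|ns_2]\rho = \sigma[ns_1|ns_2]\rho$.
   Context: A lens $X:V\Rightarrow\Sigma$ is a pair $get_X:\Sigma\to V$, $put_X:\Sigma\to V\to\Sigma$ with $get_X(put_X\,s\,v) = v$, $put_X(put_X\,s\,v')\,v = put_X\,s\,v$, and $put_X\,s\,(get_X\,s) = s$. Independence: $X\bowtie Y$ iff $put_X(put_Y\,s\,v)\,u = put_Y(put_X\,s\,u)\,v$ for all $s,u,v$. Sublens: $X\preceq Y$ (for $X:V\Rightarrow\Sigma$, $Y:W\Rightarrow\Sigma$) iff there is a lens $Z:V\Rightarrow W$ with $get_X = get_Z\circ get_Y$ and $put_X\,s\,u = put_Y\,s\,(put_Z\,(get_Y\,s)\,u)$. Override: $s_1\oplus_X s_2 = put_X\,s_1\,(get_X\,s_2)$. Substitution update: $\sigma(x\mapsto v) = \lambda s\bullet put_x\,(\sigma(s))\,(v(s))$; $id$ is the identity function on $\Sigma$. State-update merge: $(\sigma[ns_1|ns_2]\rho)(s)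 = (s\oplus_{ns_1}\sigma(s))\oplus_{ns_2}\rho(s)$. -}

module Defs where

open import Data.Product using (Σ; _×_; _,_)
open import Relation.Binary.PropositionalEquality using (_≡_)

record Lens (V S : Set) : Set where
  field
    get : S → V
    put : S → V → S
    put-get : ∀ s v → get (put s v) ≡ v
    put-put : ∀ s v' v → put (put s v') v ≡ put s v
    get-put : ∀ s → put s (get s) ≡ s
open Lens public

_⋈_ : {V W S : Set} → Lens V S → Lens W S → Set
X ⋈ Y = ∀ s u v → put X (put Y s v) u ≡ put Y (put X s u) v

_⪯_ : {V W S : Set} → Lens V S → Lens W S → Set
_⪯_ {V} {W} {S} X Y =
  Σ (Lens V W) λ Z →
    (∀ s → get X s ≡ get Z (get Y s)) ×
    (∀ s u → put X s u ≡ put Y s (put Z (get Y s) u))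

override : {V S : Set} → S → Lens V S → S → S
override s₁ X s₂ = put X s₁ (get X s₂)

subst-upd : {V S : Set} → (S → S) → Lens V S → (S → V) → (S → S)
subst-upd σ x v = λ s → put x (σ s) (v s)

merge : {V W S : Set} → (S → S) → Lens V S → Lens W S → (S → S) → (S → S)
merge σ ns₁ ns₂ ρ = λ s → override (override s ns₁ (σ s)) ns₂ (ρ s)

_≐_ : {S : Set} → (S → S) → (S → S) → Set
f ≐ g = ∀ s → f s ≡ g s

{-# OPTIONS --safe #-}
module Submission where

-- A merge σ[X|Y]ρ takes its X-view from σ and its Y-view from ρ, and when X ⋈ Y these two
-- writes commute and do not disturb each other.  Updating a sublens x of X is an X-update whose
-- new X-view depends only on the old X-view; since the merged state has the same X-view as σ s,
-- updating x before or after merging writes the same X-view.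

open import Defs
open import Data.Product using (_×_; _,_)
open import Function using (id)
open import Relation.Binary.PropositionalEquality
open ≡-Reasoning

module _ {V W S : Set} (X : Lens V S) (Y : Lens W S) where

  ⋈-sym : X ⋈ Y → Y ⋈ X
  ⋈-sym X⋈Y s u v = sym (X⋈Y s v u)

  ⋈-get-put : X ⋈ Y → ∀ s w → get X (put Y s w) ≡ get X s
  ⋈-get-put X⋈Y s w = begin
    get X (put Y s w)                    ≡⟨ cong (λ t → get X (put Y t w)) (sym (get-put X s)) ⟩
    get X (put Y (put X s (get X s)) w)  ≡⟨ cong (get X) (sym (X⋈Y s (get X s) w)) ⟩
    get X (put X (put Y s w) (get X s))  ≡⟨ put-get X (put Y s w) (get X s) ⟩
    get X s                              ∎

  ⪯-put-override : X ⪯ Y → ∀ s v → put X s v ≡ override s Y (put X s v)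
  ⪯-put-override (Z , _ , put-X) s v = begin
    put X s v                   ≡⟨ put-X s v ⟩
    put Y s z                   ≡⟨ cong (put Y s) (sym (put-get Y s z)) ⟩
    put Y s (get Y (put Y s z)) ≡⟨ cong (λ t → put Y s (get Y t)) (sym (put-X s v)) ⟩
    put Y s (get Y (put X s v)) ∎
    where z = put Z (get Y s) v

  ⪯-get-put-cong : X ⪯ Y → ∀ {s s'} v → get Y s ≡ get Y s' →
                   get Y (put X s v) ≡ get Y (put X s' v)
  ⪯-get-put-cong (Z , _ , put-X) {s} {s'} v eq = begin
    get Y (put X s v)                     ≡⟨ cong (get Y) (put-X s v) ⟩
    get Y (put Y s (put Z (get Y s) v))   ≡⟨ put-get Y s _ ⟩
    put Z (get Y s) v                     ≡⟨ cong (λ a → put Z a v) eq ⟩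
    put Z (get Y s') v                    ≡⟨ sym (put-get Y s' _) ⟩
    get Y (put Y s' (put Z (get Y s') v)) ≡⟨ cong (get Y) (sym (put-X s' v)) ⟩
    get Y (put X s' v)                    ∎

  merge-id : merge id X Y id ≐ id
  merge-id s = begin
    put Y (put X s (get X s)) (get Y s) ≡⟨ cong (λ t → put Y t (get Y s)) (get-put X s) ⟩
    put Y s (get Y s)                   ≡⟨ get-put Y s ⟩
    s                                   ∎

  merge-comm : X ⋈ Y → ∀ σ ρ → merge σ X Y ρ ≐ merge ρ Y X σ
  merge-comm X⋈Y σ ρ s = sym (X⋈Y s (get X (σ s)) (get Y (ρ s)))

  merge-cong-get : ∀ {σ σ'} ρ → (∀ s → get X (σ s) ≡ get X (σ' s)) →
                   merge σ X Y ρ ≐ merge σ' X Y ρ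
  merge-cong-get ρ eq s = cong (λ a → put Y (put X s a) (get Y (ρ s))) (eq s)

  get-merge : X ⋈ Y → ∀ σ ρ s → get X (merge σ X Y ρ s) ≡ get X (σ s)
  get-merge X⋈Y σ ρ s = begin
    get X (put Y (put X s (get X (σ s))) (get Y (ρ s))) ≡⟨ ⋈-get-put X⋈Y _ _ ⟩
    get X (put X s (get X (σ s)))                       ≡⟨ put-get X s _ ⟩
    get X (σ s)                                         ∎

  put-merge : X ⋈ Y → ∀ σ ρ s u →
              put X (merge σ X Y ρ s) u ≡ put Y (put X s u) (get Y (ρ s))
  put-merge X⋈Y σ ρ s u = begin
    put X (put Y (put X s (get X (σ s))) b) u ≡⟨ X⋈Y _ u b ⟩
    put Y (put X (put X s (get X (σ s))) u) b ≡⟨ cong (λ t → put Y t b) (put-put X s _ u) ⟩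
    put Y (put X s u) b                       ∎
    where b = get Y (ρ s)

module _ {V W₁ W₂ S : Set} (X : Lens W₁ S) (Y : Lens W₂ S)
         (σ ρ : S → S) (x : Lens V S) (v : S → V) where

  merge-subst-upd-⪯ : X ⋈ Y → x ⪯ X →
                      merge (subst-upd σ x v) X Y ρ ≐ subst-upd (merge σ X Y ρ) x v
  merge-subst-upd-⪯ X⋈Y x⪯X s = begin
    put Y (put X s (get X (put x (σ s) (v s)))) b ≡⟨ cong (λ a → put Y (put X s a) b) view-eq ⟩
    put Y (put X s (get X (put x m (v s)))) b     ≡⟨ sym (put-merge X Y X⋈Y σ ρ s _) ⟩
    put X m (get X (put x m (v s)))               ≡⟨ sym (⪯-put-override x X x⪯X m (v s)) ⟩
    put x m (v s)                                 ∎
    where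
    b = get Y (ρ s)
    m = merge σ X Y ρ s
    view-eq : get X (put x (σ s) (v s)) ≡ get X (put x m (v s))
    view-eq = ⪯-get-put-cong x X x⪯X (v s) (sym (get-merge X Y X⋈Y σ ρ s))

  merge-subst-upd-⋈ : x ⋈ X → merge (subst-upd σ x v) X Y ρ ≐ merge σ X Y ρ
  merge-subst-upd-⋈ x⋈X = merge-cong-get X Y ρ λ s → ⋈-get-put X x (⋈-sym x X x⋈X) (σ s) (v s)

theorem41 : {S V W₁ W₂ : Set} (ns₁ : Lens W₁ S) (ns₂ : Lens W₂ S) → ns₁ ⋈ ns₂ →
    (σ ρ : S → S) (x : Lens V S) (v : S → V) →
      (merge id ns₁ ns₂ id ≐ id)
      × (merge σ ns₁ ns₂ ρ ≐ merge ρ ns₂ ns₁ σ)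
      × (x ⪯ ns₁ → merge (subst-upd σ x v) ns₁ ns₂ ρ ≐ subst-upd (merge σ ns₁ ns₂ ρ) x v)
      × (x ⋈ ns₁ → merge (subst-upd σ x v) ns₁ ns₂ ρ ≐ merge σ ns₁ ns₂ ρ)
theorem41 ns₁ ns₂ ns₁⋈ns₂ σ ρ x v =
    merge-id ns₁ ns₂
  , merge-comm ns₁ ns₂ ns₁⋈ns₂ σ ρ
  , merge-subst-upd-⪯ ns₁ ns₂ σ ρ x v ns₁⋈ns₂
  , merge-subst-upd-⋈ ns₁ ns₂ σ ρ x v
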